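{- For every positive integer $m\equiv 0\pmod 2$, there is no $(3,3m;m)$-CHDM.
   Context: Let $Z_v$ denote the integers modulo $v$. A $(k,wt;w)$-CHDM is a $k\times w(t-1)$ matrix $D=(d_{ij})$ with entries in $Z_{wt}$ such that for any two distinct rows $x,y$ the list $\{d_{xj}-d_{yj}: 0\le j\le w(t-1)-1\}$ contains each element of $Z_{wt}\setminus\{0,t,\ldots,(w-1)t\}$ exactly once. -}

module Defs where

open import Data.Nat using (ℕ; zero; suc; _+_; _*_; _∸_; _<_)
open import Data.Nat.DivMod using (_%_)
open import Data.Fin using (Fin; toℕ)
open import Data.List using (List; length; filter; allFin)
open import Data.Product using (Σ; _×_)
open import Relation.Binary.PropositionalEquality using (_≡_)
open import Relation.Nullary using (¬_)
open import Data.Fin.Properties using (_≟_)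

-- Z_v is represented by Fin v.
-- Subtraction in Z_v (v = suc n):  a - b = (a + (v ∸ b)) mod v
_⊖_ : ∀ {n} → Fin (suc n) → Fin (suc n) → Fin (suc n)
_⊖_ {n} a b = Data.Fin.fromℕ< (Data.Nat.DivMod.m%n<n (toℕ a + (suc n ∸ toℕ b)) (suc n))
  where open import Data.Fin using (fromℕ<)

IsMultipleOf : (w t : ℕ) → ℕ → Set
IsMultipleOf w t x = Σ ℕ (λ i → (i < w) × (x ≡ i * t))

count : ∀ {n c} → (Fin c → Fin (suc n)) → (Fin c → Fin (suc n)) → Fin (suc n) → ℕ
count {n} {c} r s z = length (filter (λ j → (r j ⊖ s j) ≟ z) (allFin c))

-- A (k, wt; w)-CHDM: a k × w(t-1) matrix over Z_{wt} (here wt = suc n)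
-- such that for distinct rows x, y the differences d_{xj} - d_{yj} cover each
-- element of Z_{wt} \ {0, t, ..., (w-1)t} exactly once.
record CHDM (k w t n : ℕ) (wt≡ : w * t ≡ suc n) : Set where
  field
    D : Fin k → Fin (w * (t ∸ 1)) → Fin (suc n)
    diff : (x y : Fin k) → ¬ (x ≡ y) → (z : Fin (suc n)) →
           ¬ IsMultipleOf w t (toℕ z) → count (D x) (D y) z ≡ 1

-- Take rows 0, 1, 2 and let u, w, x be the column differences d₀ − d₁, d₁ − d₂, d₀ − d₂ in
-- ℤ_{3N}, so that u + w = x + q·3N columnwise.  Each of u, w, x runs exactly once through the
-- 2N elements of ℤ_{3N} not divisible by 3, and there are only 2N columns, so no column
-- difference is divisible by 3.  Reducing u + w ≡ x mod 3 then leaves two column types: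
-- u ≡ w ≡ 1, x ≡ 2 or u ≡ w ≡ 2, x ≡ 1.  Summing, over all columns, the values ≡ 1 of u and
-- of w and the values ≡ 2 of x gives 2 S₁ ≡ S₂ (mod 3N), where S_r is the sum of the elements
-- ≡ r (mod 3) of [0, 3N).  But 2 S₁ − S₂ = 3N(N − 1)/2, a multiple of 3N only for odd N.

module Submission where

open import Defs
open import Data.Nat using (ℕ; zero; suc; _+_; _*_; _∸_; _≤_; _<_; z≤n; s≤s; NonZero; ≢-nonZero)
  renaming (_≟_ to _≟ℕ_)
open import Data.Nat.Properties
  using (+-*-semiring; +-identityʳ; *-identityˡ; *-assoc; *-zeroʳ; suc-injective; <-irrefl; +-mono-≤;
         +-cancelˡ-≡; *-cancelˡ-≡; m∸n+n≡m; <⇒≤; 0≢1+n; even≢odd)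
open import Data.Nat.DivMod using (_%_; _/_; m%n<n; m≡m%n+[m/n]*n; [m+kn]%n≡m%n; m*n%n≡0;
  %-distribˡ-+; %-remove-+ʳ)
open import Data.Nat.Divisibility using (_∣_; divides; ∣-refl; ∣n⇒∣m*n)
open import Data.Nat.Tactic.RingSolver using (solve; solve-∀)
open import Data.Fin using (Fin; toℕ; inject₁; fromℕ)
import Data.Fin as F
open import Data.Fin.Patterns using (0F; 1F; 2F)
open import Data.Fin.Properties using (_≟_; toℕ-fromℕ<; toℕ-inject₁; toℕ-fromℕ; toℕ<n)
open import Data.List using ([]; _∷_; length; filter; tabulate; allFin)
open import Data.Bool using (true; false; if_then_else_)
open import Data.Product using (∃-syntax; _×_; _,_)
open import Data.Sum using (_⊎_; inj₁; inj₂)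
open import Data.Empty using (⊥-elim)
open import Function using (_∘_)
open import Level using (Level)
open import Relation.Nullary using (Dec; does; yes; no; ¬_; ¬?)
open import Relation.Unary using (Pred; Decidable)
open import Relation.Binary.PropositionalEquality
open import Algebra.Properties.Semiring.Sum +-*-semiring
  using (sum-syntax; sum-replicate-zero; ∑-comm; ∑-distrib-+; *-distribʳ-sum; sum-cong-≗; sum-init-last)

private
  variable
    a p : Level
    A : Set a

iverson : Dec A → ℕ
iverson d = if does d then 1 else 0

iverson≤1 : (d : Dec A) → iverson d ≤ 1
iverson≤1 (yes _) = s≤s z≤n
iverson≤1 (no _)  = z≤n

iverson≡1⇒ : (d : Dec A) → iverson d ≡ 1 → A
iverson≡1⇒ (yes a) _ = a
iverson≡1⇒ (no _)  ()

length-filter-tabulate : {P : Pred A p} (P? : Decidable P) {n : ℕ} (f : Fin n → A) →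
  length (filter P? (tabulate f)) ≡ ∑[ j < n ] iverson (P? (f j))
length-filter-tabulate P? {zero} f = refl
length-filter-tabulate P? {suc n} f with does (P? (f F.zero))
... | true  = cong suc (length-filter-tabulate P? (f ∘ F.suc))
... | false = length-filter-tabulate P? (f ∘ F.suc)

∑-iverson-≟ : ∀ {m} (y : Fin m) (G : Fin m → ℕ) → ∑[ z < m ] (iverson (y ≟ z) * G z) ≡ G y
∑-iverson-≟ {suc m} F.zero    G =
  trans (cong₂ _+_ (*-identityˡ (G F.zero)) (sum-replicate-zero m)) (+-identityʳ (G F.zero))
∑-iverson-≟ {suc m} (F.suc y) G = ∑-iverson-≟ y (G ∘ F.suc)

fibreSize : ∀ {c m} → (Fin c → Fin m) → Fin m → ℕ
fibreSize {c} f z = length (filter (λ j → f j ≟ z) (allFin c))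

∑-∘-by-fibres : ∀ {c m} (f : Fin c → Fin m) (G : Fin m → ℕ) →
  ∑[ j < c ] G (f j) ≡ ∑[ z < m ] (fibreSize f z * G z)
∑-∘-by-fibres {c} {m} f G = begin
  ∑[ j < c ] G (f j)                                ≡⟨ sum-cong-≗ (λ j → ∑-iverson-≟ (f j) G) ⟨
  ∑[ j < c ] ∑[ z < m ] (iverson (f j ≟ z) * G z)  ≡⟨ ∑-comm (λ j z → iverson (f j ≟ z) * G z) ⟩
  ∑[ z < m ] ∑[ j < c ] (iverson (f j ≟ z) * G z)  ≡⟨ sum-cong-≗ (λ z → *-distribʳ-sum (G z) (λ j → iverson (f j ≟ z))) ⟨
  ∑[ z < m ] (∑[ j < c ] iverson (f j ≟ z) * G z)  ≡⟨ sum-cong-≗ (λ z → cong (_* G z) (fibre z)) ⟨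
  ∑[ z < m ] (fibreSize f z * G z)                 ∎
  where
  open ≡-Reasoning
  fibre : ∀ z → fibreSize f z ≡ ∑[ j < c ] iverson (f j ≟ z)
  fibre z = length-filter-tabulate (λ j → f j ≟ z) (λ j → j)

∑-reindex : ∀ {c m} (f : Fin c → Fin m) (G : Fin m → ℕ) →
  (∀ z → G z ≡ 0 ⊎ fibreSize f z ≡ 1) → ∑[ j < c ] G (f j) ≡ ∑[ z < m ] G z
∑-reindex f G vanishes-or-hit-once = trans (∑-∘-by-fibres f G) (sum-cong-≗ weight)
  where
  weight : ∀ z → fibreSize f z * G z ≡ G z
  weight z with vanishes-or-hit-once z
  ... | inj₁ Gz≡0 rewrite Gz≡0    = *-zeroʳ (fibreSize f z)
  ... | inj₂ once rewrite once = *-identityˡ (G z)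

∑≤length : ∀ {n} (g : Fin n → ℕ) → (∀ j → g j ≤ 1) → ∑[ j < n ] g j ≤ n
∑≤length {zero}  g g≤1 = z≤n
∑≤length {suc n} g g≤1 = +-mono-≤ (g≤1 F.zero) (∑≤length (g ∘ F.suc) (g≤1 ∘ F.suc))

∑≡length⇒≡1 : ∀ {n} (g : Fin n → ℕ) → (∀ j → g j ≤ 1) → ∑[ j < n ] g j ≡ n → ∀ j → g j ≡ 1
∑≡length⇒≡1 {suc n} g g≤1 total
  with split (g F.zero) (g≤1 F.zero) (∑≤length (g ∘ F.suc) (g≤1 ∘ F.suc)) total
  where
  split : ∀ {s} b → b ≤ 1 → s ≤ n → b + s ≡ suc n → b ≡ 1 × s ≡ n
  split 0 _ s≤n refl = ⊥-elim (<-irrefl refl s≤n)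
  split 1 _ _   b+s≡1+n = refl , suc-injective b+s≡1+n
  split (suc (suc _)) (s≤s ()) _ _
... | head≡1 , tail≡n = λ where
  F.zero    → head≡1
  (F.suc i) → ∑≡length⇒≡1 (g ∘ F.suc) (g≤1 ∘ F.suc) tail≡n i

rangeSum : ℕ → (ℕ → ℕ) → ℕ
rangeSum zero    G = 0
rangeSum (suc n) G = rangeSum n G + G n

∑-toℕ : ∀ n (G : ℕ → ℕ) → ∑[ i < n ] G (toℕ i) ≡ rangeSum n G
∑-toℕ zero    G = refl
∑-toℕ (suc n) G = begin
  ∑[ i < suc n ] G (toℕ i)                               ≡⟨ sum-init-last {n} (G ∘ toℕ) ⟩
  ∑[ i < n ] G (toℕ (inject₁ i)) + G (toℕ (fromℕ n))  ≡⟨ cong₂ _+_ init≡ (cong G (toℕ-fromℕ n)) ⟩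
  rangeSum n G + G n                                     ∎
  where
  open ≡-Reasoning
  init≡ : ∑[ i < n ] G (toℕ (inject₁ i)) ≡ rangeSum n G
  init≡ = trans (sum-cong-≗ {n} (λ i → cong G (toℕ-inject₁ i))) (∑-toℕ n G)

toℕ-⊖ : ∀ {n} (a b : Fin (suc n)) → toℕ (a ⊖ b) ≡ (toℕ a + (suc n ∸ toℕ b)) % suc n
toℕ-⊖ {n} a b = toℕ-fromℕ< (m%n<n (toℕ a + (suc n ∸ toℕ b)) (suc n))

toℕ-⊖-+-⊖ : ∀ {n} (a b c : Fin (suc n)) → (toℕ (a ⊖ b) + toℕ (b ⊖ c)) % suc n ≡ toℕ (a ⊖ c)
toℕ-⊖-+-⊖ {n} a b c = begin
  (toℕ (a ⊖ b) + toℕ (b ⊖ c)) % v  ≡⟨ cong₂ (λ s t → (s + t) % v) (toℕ-⊖ a b) (toℕ-⊖ b c) ⟩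
  (X % v + Y % v) % v              ≡⟨ %-distribˡ-+ X Y v ⟨
  (X + Y) % v                      ≡⟨ cong (_% v) X+Y≡ ⟩
  (α + (v ∸ γ) + v) % v            ≡⟨ %-remove-+ʳ (α + (v ∸ γ)) (∣-refl {v}) ⟩
  (α + (v ∸ γ)) % v                ≡⟨ toℕ-⊖ a c ⟨
  toℕ (a ⊖ c)                      ∎
  where
  open ≡-Reasoning
  v = suc n
  α = toℕ a
  β = toℕ b
  γ = toℕ c
  X = α + (v ∸ β)
  Y = β + (v ∸ γ)
  X+Y≡ : X + Y ≡ α + (v ∸ γ) + v
  X+Y≡ = begin
    α + (v ∸ β) + (β + (v ∸ γ))  ≡⟨ shuffle α (v ∸ β) β (v ∸ γ) ⟩
    α + (v ∸ γ) + ((v ∸ β) + β)  ≡⟨ cong (α + (v ∸ γ) +_) (m∸n+n≡m (<⇒≤ (toℕ<n b))) ⟩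
    α + (v ∸ γ) + v              ∎
    where
    shuffle : ∀ a p b q → a + p + (b + q) ≡ a + q + (p + b)
    shuffle = solve-∀

isResidue : ℕ → ℕ → ℕ
isResidue r i = iverson (i % 3 ≟ℕ r)

atResidue : ℕ → ℕ → ℕ
atResidue r i = isResidue r i * i

nonzeroResidue : ℕ → ℕ
nonzeroResidue i = iverson (¬? (i % 3 ≟ℕ 0))

K*3%3≡0 : ∀ K → K * 3 % 3 ≡ 0
K*3%3≡0 K = m*n%n≡0 K 3

1+K*3%3≡1 : ∀ K → suc (K * 3) % 3 ≡ 1
1+K*3%3≡1 K = [m+kn]%n≡m%n 1 K 3

2+K*3%3≡2 : ∀ K → suc (suc (K * 3)) % 3 ≡ 2
2+K*3%3≡2 K = [m+kn]%n≡m%n 2 K 3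

rangeSum-atResidue-1 : ∀ K → 2 * rangeSum (K * 3) (atResidue 1) + K ≡ 3 * K * K
rangeSum-atResidue-1 zero = refl
rangeSum-atResidue-1 (suc K) rewrite K*3%3≡0 K | 1+K*3%3≡1 K | 2+K*3%3≡2 K =
  step (rangeSum (K * 3) (atResidue 1)) K (rangeSum-atResidue-1 K)
  where
  step : ∀ S K → 2 * S + K ≡ 3 * K * K →
         2 * (S + 0 + 1 * suc (K * 3) + 0) + suc K ≡ 3 * suc K * suc K
  step S K ih = begin
    2 * (S + 0 + 1 * suc (K * 3) + 0) + suc K  ≡⟨ solve (S ∷ K ∷ []) ⟩
    (2 * S + K) + (6 * K + 3)                  ≡⟨ cong (_+ (6 * K + 3)) ih ⟩
    3 * K * K + (6 * K + 3)                    ≡⟨ solve (K ∷ []) ⟩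
    3 * suc K * suc K                          ∎
    where open ≡-Reasoning

rangeSum-atResidue-2 : ∀ K → 2 * rangeSum (K * 3) (atResidue 2) ≡ 3 * K * K + K
rangeSum-atResidue-2 zero = refl
rangeSum-atResidue-2 (suc K) rewrite K*3%3≡0 K | 1+K*3%3≡1 K | 2+K*3%3≡2 K =
  step (rangeSum (K * 3) (atResidue 2)) K (rangeSum-atResidue-2 K)
  where
  step : ∀ S K → 2 * S ≡ 3 * K * K + K →
         2 * (S + 0 + 0 + 1 * suc (suc (K * 3))) ≡ 3 * suc K * suc K + suc K
  step S K ih = begin
    2 * (S + 0 + 0 + 1 * suc (suc (K * 3)))  ≡⟨ solve (S ∷ K ∷ []) ⟩
    2 * S + (6 * K + 4)                      ≡⟨ cong (_+ (6 * K + 4)) ih ⟩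
    3 * K * K + K + (6 * K + 4)              ≡⟨ solve (K ∷ []) ⟩
    3 * suc K * suc K + suc K                ∎
    where open ≡-Reasoning

atResidue-vanishes : ∀ r .{{_ : NonZero r}} i → i % 3 ≡ 0 → atResidue r i ≡ 0
atResidue-vanishes (suc r) i i%3≡0 = cong (λ s → iverson (s ≟ℕ suc r) * i) i%3≡0

nonzeroResidue-vanishes : ∀ i → i % 3 ≡ 0 → nonzeroResidue i ≡ 0
nonzeroResidue-vanishes i i%3≡0 = cong (λ s → iverson (¬? (s ≟ℕ 0))) i%3≡0

rangeSum-nonzeroResidue : ∀ K → rangeSum (K * 3) nonzeroResidue ≡ K * 2
rangeSum-nonzeroResidue zero = refl
rangeSum-nonzeroResidue (suc K)
  rewrite K*3%3≡0 K | 1+K*3%3≡1 K | 2+K*3%3≡2 K | rangeSum-nonzeroResidue K = step K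
  where
  step : ∀ K → K * 2 + 0 + 1 + 1 ≡ suc K * 2
  step = solve-∀

nonzero-residue-sum : ∀ p q r → p < 3 → q < 3 → (p + q) % 3 ≡ r → p ≢ 0 → q ≢ 0 → r ≢ 0 →
  (p ≡ 1 × q ≡ 1 × r ≡ 2) ⊎ (p ≡ 2 × q ≡ 2 × r ≡ 1)
nonzero-residue-sum 0 _ _ _ _ _ p≢0 _ _   = ⊥-elim (p≢0 refl)
nonzero-residue-sum _ 0 _ _ _ _ _ q≢0 _   = ⊥-elim (q≢0 refl)
nonzero-residue-sum 1 1 _ _ _ refl _ _ _  = inj₁ (refl , refl , refl)
nonzero-residue-sum 1 2 _ _ _ refl _ _ r≢0 = ⊥-elim (r≢0 refl)
nonzero-residue-sum 2 1 _ _ _ refl _ _ r≢0 = ⊥-elim (r≢0 refl)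
nonzero-residue-sum 2 2 _ _ _ refl _ _ _  = inj₂ (refl , refl , refl)
nonzero-residue-sum (suc (suc (suc _))) _ _ (s≤s (s≤s (s≤s ()))) _ _ _ _ _
nonzero-residue-sum (suc _) (suc (suc (suc _))) _ _ (s≤s (s≤s (s≤s ()))) _ _ _ _

-- Both column types give the same identity: in type (1, 1, 2) it is u + w = x + k itself, and
-- in type (2, 2, 1) both sides vanish.
column-identity : ∀ u w x k → u + w ≡ x + k → 3 ∣ k → u % 3 ≢ 0 → w % 3 ≢ 0 → x % 3 ≢ 0 →
  atResidue 1 u + atResidue 1 w ≡ atResidue 2 x + isResidue 1 u * k
column-identity u w x k u+w≡x+k 3∣k u≢0 w≢0 x≢0
  with nonzero-residue-sum (u % 3) (w % 3) (x % 3) (m%n<n u 3) (m%n<n w 3) residues u≢0 w≢0 x≢0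
  where
  residues : (u % 3 + w % 3) % 3 ≡ x % 3
  residues = begin
    (u % 3 + w % 3) % 3  ≡⟨ %-distribˡ-+ u w 3 ⟨
    (u + w) % 3          ≡⟨ cong (_% 3) u+w≡x+k ⟩
    (x + k) % 3          ≡⟨ %-remove-+ʳ x 3∣k ⟩
    x % 3                ∎
    where open ≡-Reasoning
... | inj₁ (u≡1 , w≡1 , x≡2) rewrite u≡1 | w≡1 | x≡2 =
  trans (cong₂ _+_ (+-identityʳ u) (+-identityʳ w))
        (trans u+w≡x+k (sym (cong₂ _+_ (+-identityʳ x) (+-identityʳ k))))
... | inj₂ (u≡2 , w≡2 , x≡1) rewrite u≡2 | w≡2 | x≡1 = refl

odd-from-residue-sums : ∀ N S₁ S₂ E .{{_ : NonZero N}} →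
  2 * S₁ + N ≡ 3 * N * N → 2 * S₂ ≡ 3 * N * N + N → S₁ + S₁ ≡ S₂ + E * (N * 3) →
  N ≡ suc (2 * E)
odd-from-residue-sums N S₁ S₂ E sum₁ sum₂ 2S₁≡S₂ =
  *-cancelˡ-≡ N (suc (2 * E)) 3 (*-cancelˡ-≡ (3 * N) (3 * suc (2 * E)) N
    (+-cancelˡ-≡ (3 * N * N) (N * (3 * N)) (N * (3 * suc (2 * E))) doubled))
  where
  open ≡-Reasoning
  doubled : 3 * N * N + N * (3 * N) ≡ 3 * N * N + N * (3 * suc (2 * E))
  doubled = begin
    3 * N * N + N * (3 * N)              ≡⟨ solve (N ∷ []) ⟩
    2 * (3 * N * N)                      ≡⟨ cong (2 *_) sum₁ ⟨
    2 * (2 * S₁ + N)                     ≡⟨ solve (S₁ ∷ N ∷ []) ⟩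
    2 * (S₁ + S₁) + 2 * N                ≡⟨ cong (λ s → 2 * s + 2 * N) 2S₁≡S₂ ⟩
    2 * (S₂ + E * (N * 3)) + 2 * N       ≡⟨ solve (S₂ ∷ E ∷ N ∷ []) ⟩
    2 * S₂ + (2 * N + 6 * N * E)         ≡⟨ cong (_+ (2 * N + 6 * N * E)) sum₂ ⟩
    3 * N * N + N + (2 * N + 6 * N * E)  ≡⟨ solve (N ∷ E ∷ []) ⟩
    3 * N * N + N * (3 * suc (2 * E))    ∎

IsMultipleOf⇒%≡0 : ∀ {w t i} .{{_ : NonZero t}} → IsMultipleOf w t i → i % t ≡ 0
IsMultipleOf⇒%≡0 {t = t} (j , _ , refl) = m*n%n≡0 j t

module _ {k w t n eq} .{{_ : NonZero t}} (chdm : CHDM k w t n eq) where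
  open CHDM chdm

  ∑-differences : ∀ {x y} → x ≢ y → (G : ℕ → ℕ) → (∀ i → i % t ≡ 0 → G i ≡ 0) →
    ∑[ j < w * (t ∸ 1) ] G (toℕ (D x j ⊖ D y j)) ≡ rangeSum (suc n) G
  ∑-differences {x} {y} x≢y G G-vanishes =
    trans (∑-reindex (λ j → D x j ⊖ D y j) (G ∘ toℕ) vanishes-or-hit-once) (∑-toℕ (suc n) G)
    where
    vanishes-or-hit-once : ∀ z → G (toℕ z) ≡ 0 ⊎ count (D x) (D y) z ≡ 1
    vanishes-or-hit-once z with toℕ z % t ≟ℕ 0
    ... | yes z%t≡0 = inj₁ (G-vanishes (toℕ z) z%t≡0)
    ... | no  z%t≢0 = inj₂ (diff x y x≢y z (z%t≢0 ∘ IsMultipleOf⇒%≡0))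

-- The 2w column differences of two rows hit each of the 2w non-multiples of 3 in ℤ_{3w} once,
-- so none of them is a multiple of 3.
module _ {k w n eq} (chdm : CHDM k w 3 n eq) where
  open CHDM chdm

  differences-%3≢0 : ∀ {x y} → x ≢ y → ∀ j → toℕ (D x j ⊖ D y j) % 3 ≢ 0
  differences-%3≢0 {x} {y} x≢y j =
    iverson≡1⇒ (¬? (δ j % 3 ≟ℕ 0))
      (∑≡length⇒≡1 (nonzeroResidue ∘ δ) (λ j → iverson≤1 (¬? (δ j % 3 ≟ℕ 0))) total j)
    where
    δ : Fin (w * 2) → ℕ
    δ j = toℕ (D x j ⊖ D y j)
    total : ∑[ j < w * 2 ] nonzeroResidue (δ j) ≡ w * 2
    total = begin
      ∑[ j < w * 2 ] nonzeroResidue (δ j)  ≡⟨ ∑-differences chdm x≢y nonzeroResidue nonzeroResidue-vanishes ⟩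
      rangeSum (suc n) nonzeroResidue      ≡⟨ cong (λ v → rangeSum v nonzeroResidue) eq ⟨
      rangeSum (w * 3) nonzeroResidue      ≡⟨ rangeSum-nonzeroResidue w ⟩
      w * 2                                ∎
      where open ≡-Reasoning

module _ {N n eq} (chdm : CHDM 3 N 3 n eq) where
  open CHDM chdm

  private
    v = suc n

    u w x : Fin (N * 2) → ℕ
    u j = toℕ (D 0F j ⊖ D 1F j)
    w j = toℕ (D 1F j ⊖ D 2F j)
    x j = toℕ (D 0F j ⊖ D 2F j)

    carry : Fin (N * 2) → ℕ
    carry j = (u j + w j) / v

    u+w≡x+carry : ∀ j → u j + w j ≡ x j + carry j * v
    u+w≡x+carry j = trans (m≡m%n+[m/n]*n (u j + w j) v)
      (cong (_+ carry j * v) (toℕ-⊖-+-⊖ (D 0F j) (D 1F j) (D 2F j)))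

    column : ∀ j → atResidue 1 (u j) + atResidue 1 (w j)
                 ≡ atResidue 2 (x j) + isResidue 1 (u j) * (carry j * v)
    column j = column-identity (u j) (w j) (x j) (carry j * v) (u+w≡x+carry j)
      (∣n⇒∣m*n (carry j) (divides N (sym eq)))
      (differences-%3≢0 chdm (λ ()) j) (differences-%3≢0 chdm (λ ()) j)
      (differences-%3≢0 chdm (λ ()) j)

    E : ℕ
    E = ∑[ j < N * 2 ] (isResidue 1 (u j) * carry j)

    S : ℕ → ℕ → ℕ
    S v r = rangeSum v (atResidue r)

    2S₁≡S₂+E*v : S v 1 + S v 1 ≡ S v 2 + E * v
    2S₁≡S₂+E*v = begin
      S v 1 + S v 1
        ≡⟨ cong₂ _+_ (∑-differences chdm {0F} {1F} (λ ()) (atResidue 1) (atResidue-vanishes 1))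
                     (∑-differences chdm {1F} {2F} (λ ()) (atResidue 1) (atResidue-vanishes 1)) ⟨
      ∑[ j < N * 2 ] atResidue 1 (u j) + ∑[ j < N * 2 ] atResidue 1 (w j)
        ≡⟨ ∑-distrib-+ (atResidue 1 ∘ u) (atResidue 1 ∘ w) ⟨
      ∑[ j < N * 2 ] (atResidue 1 (u j) + atResidue 1 (w j))
        ≡⟨ sum-cong-≗ column ⟩
      ∑[ j < N * 2 ] (atResidue 2 (x j) + isResidue 1 (u j) * (carry j * v))
        ≡⟨ ∑-distrib-+ (atResidue 2 ∘ x) (λ j → isResidue 1 (u j) * (carry j * v)) ⟩
      ∑[ j < N * 2 ] atResidue 2 (x j) + ∑[ j < N * 2 ] (isResidue 1 (u j) * (carry j * v))
        ≡⟨ cong₂ _+_ (∑-differences chdm {0F} {2F} (λ ()) (atResidue 2) (atResidue-vanishes 2)) carries ⟩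
      S v 2 + E * v
        ∎
      where
      open ≡-Reasoning
      carries : ∑[ j < N * 2 ] (isResidue 1 (u j) * (carry j * v)) ≡ E * v
      carries = trans (sum-cong-≗ (λ j → sym (*-assoc (isResidue 1 (u j)) (carry j) v)))
                      (sym (*-distribʳ-sum v (λ j → isResidue 1 (u j) * carry j)))

    N≢0 : N ≢ 0
    N≢0 refl = 0≢1+n eq

  CHDM-3-N-3⇒odd : ∃[ E ] N ≡ suc (2 * E)
  CHDM-3-N-3⇒odd = E , odd-from-residue-sums N (S (N * 3) 1) (S (N * 3) 2) E {{≢-nonZero N≢0}}
    (rangeSum-atResidue-1 N) (rangeSum-atResidue-2 N)
    (subst (λ v → S v 1 + S v 1 ≡ S v 2 + E * v) (sym eq) 2S₁≡S₂+E*v)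

lemma5p6 : (h : ℕ) → (n : ℕ) → (eq : (2 * suc h) * 3 ≡ suc n) →
    ¬ CHDM 3 (2 * suc h) 3 n eq
lemma5p6 h n eq chdm = let E , 2[1+h]≡1+2E = CHDM-3-N-3⇒odd chdm in
  even≢odd (suc h) E 2[1+h]≡1+2E
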